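{- Let $m$ be an odd positive integer with $m = 2n - 1$, where $n \ge 2$, and write $m = 2^p \cdot (2q+1) - 1$ with $p \ge 1$, $q \ge 0$ (so $2^p$ is the exact power of $2$ dividing $m+1$). Then $T^{p+2}(m-1) = T^{p+2}(m)$ if and only if $C(n) = 1$.
   Context: $T:\mathbb{Z}^+\to\mathbb{Z}^+$ is defined by $T(x) = x/2$ if $x$ is even and $T(x) = (3x+1)/2$ if $x$ is odd; $T^k$ denotes the $k$-fold composition of $T$ with itself, with $T^0$ the identity. The function $C:\mathbb{Z}^+\to\{0,1\}$ is defined recursively by $C(1) = 0$, $C(n) = 1 - C(n-2)$ if $n > 1$ is odd, and $C(n) = 1 - C(n/2)$ if $n$ is even. -}

module Defs where

open import Data.Nat using (ℕ; zero; suc; _+_; _*_; _∸_)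
open import Data.Bool using (if_then_else_)
open import Data.Nat.Base using (_/_; _%_; _≡ᵇ_)
open import Function using (_∘_)

T : ℕ → ℕ
T x = if x % 2 ≡ᵇ 0 then x / 2 else (3 * x + 1) / 2

iterT : ℕ → ℕ → ℕ
iterT zero    x = x
iterT (suc k) x = T (iterT k x)

-- C(1) = 0, C(n) = 1 - C(n-2) for odd n > 1, C(n) = 1 - C(n/2) for even n.
-- Implemented with a fuel argument (fuel ≥ n suffices, since each recursive
-- call decreases the argument); C 0 is irrelevant (set to 0).
Cfuel : ℕ → ℕ → ℕ
Cfuel zero    _ = 0
Cfuel (suc f) 0 = 0
Cfuel (suc f) 1 = 0
Cfuel (suc f) (suc (suc k)) =
  if suc (suc k) % 2 ≡ᵇ 0
    then 1 ∸ Cfuel f (suc (suc k) / 2)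
    else 1 ∸ Cfuel f k

C : ℕ → ℕ
C n = Cfuel n n

module Submission where

-- Write n = 2^a (1 + 2q), so that p = a + 1. Since T (2x − 1) = 3x − 1, the orbits of
-- m = 2^(a+1) (1 + 2q) − 1 and of m − 1 = 2 (n − 1) pass through 3^(a+1) (1 + 2q) − 1 = 2 (3r + 1)
-- and 3^a (1 + 2q) − 1 = 2r respectively, where 3^a (1 + 2q) = 1 + 2r; two more steps give
-- T (3r + 1) and T r, which agree exactly when r is odd. Each factor 3 flips the parity of r,
-- as 3 (1 + 2t) = 1 + 2 (1 + 3t), and each halving or step 2t + 1 ↦ 2t + 3 flips C,
-- so r and C n both have the parity of a + q.

open import Defs
open import Data.Nat using (ℕ; _+_; _*_; _∸_; _^_; _≤_)
open import Relation.Binary.PropositionalEquality using (_≡_)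
open import Function.Bundles using (_⇔_)

open import Data.Bool.Base using (true; false)
open import Data.Nat.Base using (zero; suc; _<_; _%_; _/_; _≡ᵇ_; s≤s; z≤n; NonZero; >-nonZero; parity)
open import Data.Nat.DivMod using (m*n%n≡0; [m+kn]%n≡m%n; m*n/n≡m; m/n<m)
open import Data.Nat.Properties
open import Algebra.Properties.CommutativeSemigroup *-commutativeSemigroup using (x∙yz≈y∙xz)
open import Data.Nat.Tactic.RingSolver using (solve-∀)
open import Data.Parity.Base as ℙ using (Parity; 0ℙ; 1ℙ; _⁻¹)
open import Data.Parity.Properties using (+-homo-+; *-homo-*) renaming (+-identityʳ to ℙ-+-identityʳ)
open import Data.Product using (∃-syntax; _×_; _,_)
open import Data.Sum using (_⊎_; inj₁; inj₂)
open import Function.Base using (_∘_)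
open import Function.Bundles using (mk⇔)
import Function.Properties.Equivalence as ⇔
open import Relation.Binary.PropositionalEquality
  using (refl; sym; trans; cong; module ≡-Reasoning)
open import Relation.Nullary using (contradiction)

2*j%2≡0 : ∀ j → 2 * j % 2 ≡ 0
2*j%2≡0 j rewrite *-comm 2 j = m*n%n≡0 j 2

[1+2*j]%2≡1 : ∀ j → (1 + 2 * j) % 2 ≡ 1
[1+2*j]%2≡1 j rewrite *-comm 2 j = [m+kn]%n≡m%n 1 j 2

2*j/2≡j : ∀ j → 2 * j / 2 ≡ j
2*j/2≡j j rewrite *-comm 2 j = m*n/n≡m j 2

even⊎odd : ∀ r → (∃[ j ] r ≡ 2 * j) ⊎ (∃[ j ] r ≡ 1 + 2 * j)
even⊎odd zero = inj₁ (0 , refl)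
even⊎odd (suc r) with even⊎odd r
... | inj₁ (j , refl) = inj₂ (j , refl)
... | inj₂ (j , refl) = inj₁ (suc j , sym (*-suc 2 j))

parity-2*j : ∀ j → parity (2 * j) ≡ 0ℙ
parity-2*j j = *-homo-* 2 j

parity-1+2*j : ∀ j → parity (1 + 2 * j) ≡ 1ℙ
parity-1+2*j j = trans (+-homo-+ 1 (2 * j)) (cong _⁻¹ (parity-2*j j))

parity-+-2*j : ∀ n j → parity (n + 2 * j) ≡ parity n
parity-+-2*j n j = trans (+-homo-+ n (2 * j))
  (trans (cong (parity n ℙ.+_) (parity-2*j j)) (ℙ-+-identityʳ (parity n)))

toℕ : Parity → ℕ
toℕ 0ℙ = 0
toℕ 1ℙ = 1

toℕ-⁻¹ : ∀ π → toℕ (π ⁻¹) ≡ 1 ∸ toℕ π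
toℕ-⁻¹ 0ℙ = refl
toℕ-⁻¹ 1ℙ = refl

≡1ℙ⇔toℕ≡1 : ∀ π → π ≡ 1ℙ ⇔ toℕ π ≡ 1
≡1ℙ⇔toℕ≡1 0ℙ = mk⇔ (λ ()) (λ ())
≡1ℙ⇔toℕ≡1 1ℙ = mk⇔ (λ _ → refl) (λ _ → refl)

3*[1+2*j]+1≡2*[3*j+2] : ∀ j → 3 * (1 + 2 * j) + 1 ≡ 2 * (3 * j + 2)
3*[1+2*j]+1≡2*[3*j+2] = solve-∀

3*[1+2*j]≡1+2*[1+3*j] : ∀ j → 3 * (1 + 2 * j) ≡ 1 + 2 * (1 + 3 * j)
3*[1+2*j]≡1+2*[1+3*j] = solve-∀

3*[2*j]+1≡1+2*[3*j] : ∀ j → 3 * (2 * j) + 1 ≡ 1 + 2 * (3 * j)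
3*[2*j]+1≡1+2*[3*j] = solve-∀

T-double : ∀ j → T (2 * j) ≡ j
T-double j rewrite 2*j%2≡0 j = 2*j/2≡j j

T-1+2*j : ∀ j → T (1 + 2 * j) ≡ 3 * j + 2
T-1+2*j j rewrite [1+2*j]%2≡1 j =
  trans (cong (_/ 2) (3*[1+2*j]+1≡2*[3*j+2] j)) (2*j/2≡j (3 * j + 2))

T-2*x∸1 : ∀ x → T (2 * x ∸ 1) ≡ 3 * x ∸ 1
T-2*x∸1 zero    = refl
T-2*x∸1 (suc v) = begin
  T (2 * suc v ∸ 1)  ≡⟨ cong (λ y → T (y ∸ 1)) (*-suc 2 v) ⟩
  T (1 + 2 * v)      ≡⟨ T-1+2*j v ⟩
  3 * v + 2          ≡⟨ +-comm (3 * v) 2 ⟩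
  2 + 3 * v          ≡⟨ cong (_∸ 1) (sym (*-suc 3 v)) ⟩
  3 * suc v ∸ 1      ∎
  where open ≡-Reasoning

T≡T[3r+1]⇔odd : ∀ r → T r ≡ T (3 * r + 1) ⇔ parity r ≡ 1ℙ
T≡T[3r+1]⇔odd r with even⊎odd r
... | inj₁ (j , refl) = mk⇔
  (λ eq → contradiction (trans (sym (T-double j)) (trans eq T[6j+1]≡9j+2)) (<⇒≢ j<9j+2))
  (λ odd → contradiction (trans (sym (parity-2*j j)) odd) λ ())
  where
  T[6j+1]≡9j+2 : T (3 * (2 * j) + 1) ≡ 3 * (3 * j) + 2
  T[6j+1]≡9j+2 = trans (cong T (3*[2*j]+1≡1+2*[3*j] j)) (T-1+2*j (3 * j))
  j<9j+2 : j < 3 * (3 * j) + 2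
  j<9j+2 = ≤-<-trans (≤-trans (m≤n*m j 3) (m≤n*m (3 * j) 3)) (m<m+n _ (s≤s z≤n))
... | inj₂ (j , refl) = mk⇔
  (λ _ → parity-1+2*j j)
  (λ _ → trans (T-1+2*j j) (sym (trans (cong T (3*[1+2*j]+1≡2*[3*j+2] j)) (T-double (3 * j + 2)))))

iterT-suc : ∀ k x → iterT (suc k) x ≡ iterT k (T x)
iterT-suc zero    x = refl
iterT-suc (suc k) x = cong T (iterT-suc k x)

iterT-+2 : ∀ k x → iterT (k + 2) x ≡ T (T (iterT k x))
iterT-+2 k x = cong (λ i → iterT i x) (+-comm k 2)

iterT-2^k*s∸1 : ∀ k s → iterT k (2 ^ k * s ∸ 1) ≡ 3 ^ k * s ∸ 1
iterT-2^k*s∸1 zero    s = refl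
iterT-2^k*s∸1 (suc k) s = begin
  iterT (suc k) (2 * 2 ^ k * s ∸ 1)  ≡⟨ iterT-suc k _ ⟩
  iterT k (T (2 * 2 ^ k * s ∸ 1))    ≡⟨ cong (λ y → iterT k (T (y ∸ 1))) (*-assoc 2 (2 ^ k) s) ⟩
  iterT k (T (2 * (2 ^ k * s) ∸ 1))  ≡⟨ cong (iterT k) (T-2*x∸1 (2 ^ k * s)) ⟩
  iterT k (3 * (2 ^ k * s) ∸ 1)      ≡⟨ cong (λ y → iterT k (y ∸ 1)) (x∙yz≈y∙xz 3 (2 ^ k) s) ⟩
  iterT k (2 ^ k * (3 * s) ∸ 1)      ≡⟨ iterT-2^k*s∸1 k (3 * s) ⟩
  3 ^ k * (3 * s) ∸ 1                ≡⟨ cong (_∸ 1) (x∙yz≈y∙xz (3 ^ k) 3 s) ⟩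
  3 * (3 ^ k * s) ∸ 1                ≡⟨ cong (_∸ 1) (sym (*-assoc 3 (3 ^ k) s)) ⟩
  3 * 3 ^ k * s ∸ 1                  ∎
  where open ≡-Reasoning

iterT-2*2^a*s∸1∸1 : ∀ a s r → 3 ^ a * s ≡ 1 + 2 * r →
            iterT (suc a + 2) (2 * (2 ^ a * s) ∸ 1 ∸ 1) ≡ T r
iterT-2*2^a*s∸1∸1 a s r 3^a*s≡1+2r = begin
  iterT (suc a + 2) (2 * n ∸ 1 ∸ 1)     ≡⟨ iterT-+2 (suc a) _ ⟩
  T (T (iterT (suc a) (2 * n ∸ 1 ∸ 1)))  ≡⟨ cong (T ∘ T) (iterT-suc a _) ⟩
  T (T (iterT a (T (2 * n ∸ 1 ∸ 1))))    ≡⟨ cong (λ x → T (T (iterT a (T x)))) 2*n∸1∸1≡2*[n∸1] ⟩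
  T (T (iterT a (T (2 * (n ∸ 1)))))      ≡⟨ cong (λ x → T (T (iterT a x))) (T-double (n ∸ 1)) ⟩
  T (T (iterT a (n ∸ 1)))                ≡⟨ cong (T ∘ T) (iterT-2^k*s∸1 a s) ⟩
  T (T (3 ^ a * s ∸ 1))                  ≡⟨ cong (λ x → T (T (x ∸ 1))) 3^a*s≡1+2r ⟩
  T (T (2 * r))                          ≡⟨ cong T (T-double r) ⟩
  T r                                    ∎
  where
  open ≡-Reasoning
  n = 2 ^ a * s
  2*n∸1∸1≡2*[n∸1] : 2 * n ∸ 1 ∸ 1 ≡ 2 * (n ∸ 1)
  2*n∸1∸1≡2*[n∸1] = trans (∸-+-assoc (2 * n) 1 1) (sym (*-distribˡ-∸ 2 n 1))

iterT-2*2^a*s∸1 : ∀ a s r → 3 ^ a * s ≡ 1 + 2 * r →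
          iterT (suc a + 2) (2 * (2 ^ a * s) ∸ 1) ≡ T (3 * r + 1)
iterT-2*2^a*s∸1 a s r 3^a*s≡1+2r = begin
  iterT (suc a + 2) (2 * (2 ^ a * s) ∸ 1)  ≡⟨ iterT-+2 (suc a) _ ⟩
  T (T (iterT (suc a) (2 * (2 ^ a * s) ∸ 1)))
    ≡⟨ cong (λ x → T (T (iterT (suc a) (x ∸ 1)))) (sym (*-assoc 2 (2 ^ a) s)) ⟩
  T (T (iterT (suc a) (2 ^ suc a * s ∸ 1)))  ≡⟨ cong (T ∘ T) (iterT-2^k*s∸1 (suc a) s) ⟩
  T (T (3 * 3 ^ a * s ∸ 1))                ≡⟨ cong (λ x → T (T (x ∸ 1))) (*-assoc 3 (3 ^ a) s) ⟩
  T (T (3 * (3 ^ a * s) ∸ 1))              ≡⟨ cong (λ x → T (T (3 * x ∸ 1))) 3^a*s≡1+2r ⟩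
  T (T (3 * (1 + 2 * r) ∸ 1))              ≡⟨ cong (λ x → T (T (x ∸ 1))) (3*[1+2*j]≡1+2*[1+3*j] r) ⟩
  T (T (2 * (1 + 3 * r)))                  ≡⟨ cong T (T-double (1 + 3 * r)) ⟩
  T (1 + 3 * r)                            ≡⟨ cong T (+-comm 1 (3 * r)) ⟩
  T (3 * r + 1)                            ∎
  where open ≡-Reasoning

a+[1+3t]≡[1+a+t]+2t : ∀ a t → a + (1 + 3 * t) ≡ suc a + t + 2 * t
a+[1+3t]≡[1+a+t]+2t = solve-∀

3^a*[1+2*t]-half : ∀ a t → ∃[ r ] 3 ^ a * (1 + 2 * t) ≡ 1 + 2 * r × parity r ≡ parity (a + t)
3^a*[1+2*t]-half zero    t = t , *-identityˡ (1 + 2 * t) , refl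
3^a*[1+2*t]-half (suc a) t with 3^a*[1+2*t]-half a (1 + 3 * t)
... | r , 3^a*s′≡1+2r , parity-r = r , 3^[1+a]*s≡1+2r , trans parity-r parity-a+[1+3t]
  where
  3^[1+a]*s≡1+2r : 3 * 3 ^ a * (1 + 2 * t) ≡ 1 + 2 * r
  3^[1+a]*s≡1+2r = trans (*-assoc 3 (3 ^ a) _)
    (trans (x∙yz≈y∙xz 3 (3 ^ a) _)
    (trans (cong (3 ^ a *_) (3*[1+2*j]≡1+2*[1+3*j] t)) 3^a*s′≡1+2r))
  parity-a+[1+3t] : parity (a + (1 + 3 * t)) ≡ parity (suc a + t)
  parity-a+[1+3t] = trans (cong parity (a+[1+3t]≡[1+a+t]+2t a t)) (parity-+-2*j (suc a + t) t)

Cfuel-stable : ∀ {f g} n → n ≤ f → n ≤ g → Cfuel f n ≡ Cfuel g n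
Cfuel-stable {f} {g} zero _ _ = trans (Cfuel-0 f) (sym (Cfuel-0 g))
  where
  Cfuel-0 : ∀ f → Cfuel f 0 ≡ 0
  Cfuel-0 zero    = refl
  Cfuel-0 (suc f) = refl
Cfuel-stable {suc f} {suc g} (suc zero) _ _ = refl
Cfuel-stable {suc f} {suc g} (suc (suc k)) (s≤s 1+k≤f) (s≤s 1+k≤g) with suc (suc k) % 2 ≡ᵇ 0
... | true  = cong (1 ∸_) (Cfuel-stable _ (≤-trans half≤1+k 1+k≤f) (≤-trans half≤1+k 1+k≤g))
  where
  half≤1+k : (2 + k) / 2 ≤ suc k
  half≤1+k = ≤-pred (m/n<m (2 + k) 2 (s≤s (s≤s z≤n)))
... | false = cong (1 ∸_) (Cfuel-stable k (≤-trans (n≤1+n k) 1+k≤f) (≤-trans (n≤1+n k) 1+k≤g))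

C-odd-step : ∀ k → k % 2 ≡ 1 → C (2 + k) ≡ 1 ∸ C k
C-odd-step k k%2≡1 rewrite k%2≡1 = cong (1 ∸_) (Cfuel-stable k (n≤1+n k) ≤-refl)

C-double : ∀ x .{{_ : NonZero x}} → C (2 * x) ≡ 1 ∸ C x
C-double (suc u) rewrite *-suc 2 u | 2*j%2≡0 u =
  cong (1 ∸_) (trans (cong (Cfuel (suc (2 * u))) [2+2u]/2≡1+u)
                     (Cfuel-stable (suc u) (s≤s (m≤n*m u 2)) ≤-refl))
  where
  [2+2u]/2≡1+u : (2 + 2 * u) / 2 ≡ suc u
  [2+2u]/2≡1+u = trans (cong (_/ 2) (sym (*-suc 2 u))) (2*j/2≡j (suc u))

C-1+2*t : ∀ t → C (1 + 2 * t) ≡ toℕ (parity t)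
C-1+2*t zero    = refl
C-1+2*t (suc t) = begin
  C (1 + 2 * suc t)       ≡⟨ cong (λ x → C (1 + x)) (*-suc 2 t) ⟩
  C (2 + (1 + 2 * t))     ≡⟨ C-odd-step (1 + 2 * t) ([1+2*j]%2≡1 t) ⟩
  1 ∸ C (1 + 2 * t)       ≡⟨ cong (1 ∸_) (C-1+2*t t) ⟩
  1 ∸ toℕ (parity t)      ≡⟨ toℕ-⁻¹ (parity t) ⟨
  toℕ (parity t ⁻¹)       ≡⟨ cong toℕ (+-homo-+ 1 t) ⟨
  toℕ (parity (suc t))    ∎
  where open ≡-Reasoning

C-2^a*[1+2*t] : ∀ a t → C (2 ^ a * (1 + 2 * t)) ≡ toℕ (parity (a + t))
C-2^a*[1+2*t] zero    t = trans (cong C (*-identityˡ (1 + 2 * t))) (C-1+2*t t)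
C-2^a*[1+2*t] (suc a) t = begin
  C (2 * 2 ^ a * (1 + 2 * t))     ≡⟨ cong C (*-assoc 2 (2 ^ a) _) ⟩
  C (2 * (2 ^ a * (1 + 2 * t)))   ≡⟨ C-double _ {{m*n≢0 (2 ^ a) _ {{m^n≢0 2 a}}}} ⟩
  1 ∸ C (2 ^ a * (1 + 2 * t))     ≡⟨ cong (1 ∸_) (C-2^a*[1+2*t] a t) ⟩
  1 ∸ toℕ (parity (a + t))        ≡⟨ toℕ-⁻¹ (parity (a + t)) ⟨
  toℕ (parity (a + t) ⁻¹)         ≡⟨ cong toℕ (+-homo-+ 1 (a + t)) ⟨
  toℕ (parity (suc a + t))        ∎
  where open ≡-Reasoning

2*m∸1-injective : ∀ {m n} .{{_ : NonZero m}} .{{_ : NonZero n}} → 2 * m ∸ 1 ≡ 2 * n ∸ 1 → m ≡ n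
2*m∸1-injective {suc m} {suc n} eq =
  *-cancelˡ-≡ (suc m) (suc n) 2 (∸-cancelʳ-≡ (s≤s z≤n) (s≤s z≤n) eq)

2*n∸1≡2^[1+a]*[2q+1]∸1⇒n≡2^a*[1+2q] : ∀ {n} a q → 2 ≤ n →
  2 * n ∸ 1 ≡ 2 ^ suc a * (2 * q + 1) ∸ 1 → n ≡ 2 ^ a * (1 + 2 * q)
2*n∸1≡2^[1+a]*[2q+1]∸1⇒n≡2^a*[1+2q] a q 2≤n m≡ =
  2*m∸1-injective {{>-nonZero (≤-trans (n≤1+n 1) 2≤n)}} {{m*n≢0 (2 ^ a) (1 + 2 * q) {{m^n≢0 2 a}}}}
    (trans m≡ (cong (_∸ 1) (trans (*-assoc 2 (2 ^ a) _) (cong (λ s → 2 * (2 ^ a * s)) (+-comm (2 * q) 1)))))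

theorem4p1 : (n p q : ℕ) → 2 ≤ n → 1 ≤ p →
    2 * n ∸ 1 ≡ 2 ^ p * (2 * q + 1) ∸ 1 →
    (iterT (p + 2) (2 * n ∸ 1 ∸ 1) ≡ iterT (p + 2) (2 * n ∸ 1) ⇔ C n ≡ 1)
theorem4p1 n zero    q _   () _
theorem4p1 n (suc a) q 2≤n _  m≡ with 3^a*[1+2*t]-half a q
... | r , 3^a*s≡1+2r , parity-r
  rewrite 2*n∸1≡2^[1+a]*[2q+1]∸1⇒n≡2^a*[1+2q] a q 2≤n m≡
        | iterT-2*2^a*s∸1∸1 a _ r 3^a*s≡1+2r
        | iterT-2*2^a*s∸1 a _ r 3^a*s≡1+2r
        | C-2^a*[1+2*t] a q
        | sym parity-r
        = ⇔.trans (T≡T[3r+1]⇔odd r) (≡1ℙ⇔toℕ≡1 (parity r))
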